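{- Let $p(x)=a_0+\dots+a_mx^m$ and $q(x)=b_0+\dots+b_mx^m$ be polynomials of degree $m$ over a field $F$ of characteristic zero, and let $a_{k,n}$ and $b_{k,n}$ denote the entries of $B(p(x))$ and $B(q(x))$. If $p$ and $q$ are both palindromic, then for all $l\in\mathbb{Z}$, $$\sum_{k=0}^m a_{k,-l}b_{m-k,l}=\sum_{k=0}^m a_kb_{m-k}=\begin{cases}2\sum_{k=0}^{(m-1)/2}a_kb_k & m\text{ odd},\\ a_{m/2}b_{m/2}+2\sum_{k=0}^{(m-2)/2}a_kb_k & m\text{ even}.\end{cases}$$ If $p$ and $q$ are both skew-palindromic, then for all $l\in\mathbb{Z}$, $$\sum_{k=0}^m a_{k,-l}b_{m-k,l}=\sum_{k=0}^m a_kb_{m-k}=-2\sum_{k=0}^{\lfloor m/2\rfloor}a_kb_k.$$ If $p$ is palindromic and $q$ is skew-palindromic, then for all $l\in\mathbb{Z}$, $$\sum_{k=0}^m a_{k,-l}b_{m-k,l}=\sum_{k=0}^m a_kb_{m-k}=0.$$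
   Context: A polynomial $p(x)$ of degree $m$ is palindromic if $p(x)=x^mp(1/x)$ (i.e. $a_k=a_{m-k}$) and skew-palindromic if $p(x)=-x^mp(1/x)$ (i.e. $a_k=-a_{m-k}$). The binomial array $B(p(x))$ has entries $a_{k,n}$ ($k\ge0$, $n\in\mathbb{Z}$) equal to the coefficient of $x^k$ in $(1+x)^np(x)$, with $(1+x)^n$ the inverse power series when $n<0$. -}

module Defs where

open import Level using (Level; _⊔_)
open import Algebra.Bundles using (CommutativeRing)
open import Data.Nat as ℕ using (ℕ; zero; suc; _∸_; _≤_; _<_)
open import Data.Nat.Combinatorics using (_C_)
open import Data.Integer as ℤ using (ℤ; +_; -[1+_])
open import Data.Product using (Σ; _×_)
open import Relation.Nullary using (¬_)
open import Relation.Binary.PropositionalEquality using (_≡_)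


-- binom n i = coefficient of x^i in the (inverse) power series (1+x)^n, n ∈ ℤ.
-- For n ≥ 0 it is the usual binomial coefficient; for n < 0 it is
-- determined by (1+x)^n · (1+x) = (1+x)^(n+1), i.e.
-- binom n 0 = 1 and binom n (i+1) = binom (n+1) (i+1) - binom n i.
binom : ℤ → ℕ → ℤ
binom (+ n) i                  = + (n C i)
binom -[1+ j ] zero            = ℤ.1ℤ
binom -[1+ zero ] (suc i)      = binom (+ 0) (suc i) ℤ.- binom -[1+ zero ] i
binom -[1+ suc j ] (suc i)     = binom -[1+ j ] (suc i) ℤ.- binom -[1+ suc j ] i

record Field (c ℓ : Level) : Set (Level.suc (c ⊔ ℓ)) where
  field
    commutativeRing : CommutativeRing c ℓ
  open CommutativeRing commutativeRing public
  field
    0≉1     : ¬ (0# ≈ 1#)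
    inverse : ∀ x → ¬ (x ≈ 0#) → Σ Carrier (λ y → x * y ≈ 1#)

module FieldDefs {c ℓ : Level} (F : Field c ℓ) where
  open Field F

  _×1 : ℕ → Carrier
  zero ×1  = 0#
  suc n ×1 = 1# + n ×1

  ι : ℤ → Carrier
  ι (+ n)     = n ×1
  ι -[1+ n ]  = - (suc n ×1)

  CharZero : Set ℓ
  CharZero = ∀ n → n ×1 ≈ 0# → n ≡ 0

  sumBelow : ℕ → (ℕ → Carrier) → Carrier
  sumBelow zero f    = 0#
  sumBelow (suc n) f = sumBelow n f + f n

  sumTo : ℕ → (ℕ → Carrier) → Carrier
  sumTo m f = sumBelow (suc m) f

  -- A polynomial a_0 + ... + a_m x^m of degree m is given by its coefficient
  -- sequence a : ℕ → F with a_k = 0 for k > m and a_m ≠ 0.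
  HasDegree : ℕ → (ℕ → Carrier) → Set ℓ
  HasDegree m a = (∀ k → m < k → a k ≈ 0#) × ¬ (a m ≈ 0#)

  Palindromic : ℕ → (ℕ → Carrier) → Set ℓ
  Palindromic m a = ∀ k → k ≤ m → a k ≈ a (m ∸ k)

  SkewPalindromic : ℕ → (ℕ → Carrier) → Set ℓ
  SkewPalindromic m a = ∀ k → k ≤ m → a k ≈ - a (m ∸ k)

  -- binomial array entry a_{k,n} = coefficient of x^k in (1+x)^n p(x)
  --   = Σ_{j=0}^{k} binom n (k - j) · a_j
  entry : (ℕ → Carrier) → ℕ → ℤ → Carrier
  entry a k n = sumTo k (λ j → ι (binom n (k ∸ j)) * a j)

-- Read as generating functions, the left-hand sum is the coefficient of x^m in
-- ((1+x)^(-l) p(x)) ((1+x)^l q(x)); shifting one factor 1 + x from one side to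
-- the other changes nothing, so by induction on l it equals the coefficient of
-- x^m in p(x) q(x).  For the closed forms, (skew-)palindromicity of q turns
-- b_(m-k) into ±b_k, the sequence a_k b_k is palindromic or skew-palindromic,
-- and its sum folds in half; in characteristic zero an element equal to its own
-- negative vanishes, which kills the middle term and the mixed sum.

module Submission where

open import Defs
open import Level using (Level)
open import Data.Nat using (ℕ; _∸_; _/_; _%_)
open import Data.Integer as ℤ using (ℤ)
open import Data.Product using (_×_)
open import Relation.Binary.PropositionalEquality using (_≡_)

open import Data.Nat as ℕ using (zero; suc; _≤_; _<_; s≤s; s≤s⁻¹)
import Data.Nat.Properties as ℕ
import Data.Integer.Properties as ℤ
open import Data.Nat.DivMod using (m≡m%n+[m/n]*n; m%n<n)
open import Data.Nat.Combinatorics using (_C_; nCk+nC[k+1]≡[n+1]C[k+1])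
open import Data.Integer using (+_; -[1+_])
open import Data.Integer.Tactic.RingSolver using (solve-∀)
open import Data.Product using (_,_)
open import Data.Sum using (_⊎_; inj₁; inj₂)
open import Relation.Binary.Bundles using (Setoid)
open import Relation.Nullary using (¬_)
import Relation.Binary.PropositionalEquality as ≡

m*2≡m+m : ∀ m → m ℕ.* 2 ≡ m ℕ.+ m
m*2≡m+m m = ≡.trans (ℕ.*-comm m 2) (≡.cong (m ℕ.+_) (ℕ.+-identityʳ m))

m%2≡1⇒m≡1+[m/2+m/2] : ∀ m → m % 2 ≡ 1 → m ≡ suc (m / 2 ℕ.+ m / 2)
m%2≡1⇒m≡1+[m/2+m/2] m e = ≡.trans (m≡m%n+[m/n]*n m 2) (≡.cong₂ ℕ._+_ e (m*2≡m+m (m / 2)))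

m%2≡0⇒m≡m/2+m/2 : ∀ m → m % 2 ≡ 0 → m ≡ m / 2 ℕ.+ m / 2
m%2≡0⇒m≡m/2+m/2 m e = ≡.trans (m≡m%n+[m/n]*n m 2) (≡.cong₂ ℕ._+_ e (m*2≡m+m (m / 2)))

m%2≡0⊎m%2≡1 : ∀ m → m % 2 ≡ 0 ⊎ m % 2 ≡ 1
m%2≡0⊎m%2≡1 m with m % 2 | m%n<n m 2
... | 0 | _ = inj₁ ≡.refl
... | 1 | _ = inj₂ ≡.refl
... | suc (suc _) | s≤s (s≤s ())

i≡[i-j]+j : ∀ i j → i ≡ (i ℤ.- j) ℤ.+ j
i≡[i-j]+j = solve-∀

suc-[-suc-i]≡-i : ∀ i → ℤ.1ℤ ℤ.+ ℤ.- (ℤ.1ℤ ℤ.+ i) ≡ ℤ.- i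
suc-[-suc-i]≡-i = solve-∀

binom-zero : ∀ n → binom n 0 ≡ ℤ.1ℤ
binom-zero (+ k)    = ≡.refl
binom-zero -[1+ k ] = ≡.refl

binom-pascal : ∀ n i → binom (ℤ.suc n) (suc i) ≡ binom n (suc i) ℤ.+ binom n i
binom-pascal (+ k) i =
  ≡.cong +_ (≡.trans (≡.sym (nCk+nC[k+1]≡[n+1]C[k+1] k i)) (ℕ.+-comm (k C i) (k C suc i)))
binom-pascal -[1+ zero ]  i = i≡[i-j]+j (binom (+ 0) (suc i)) (binom -[1+ zero ] i)
binom-pascal -[1+ suc j ] i = i≡[i-j]+j (binom -[1+ j ] (suc i)) (binom -[1+ suc j ] i)

suc-invariant⇒constant : ∀ {c ℓ} (S : Setoid c ℓ) (let open Setoid S) (f : ℤ → Carrier) →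
                         (∀ n → f (ℤ.suc n) ≈ f n) → ∀ n → f n ≈ f (+ 0)
suc-invariant⇒constant S f step = go
  where
  open Setoid S
  go : ∀ n → f n ≈ f (+ 0)
  go (+ zero)          = refl
  go (+ suc k)         = trans (step (+ k)) (go (+ k))
  go -[1+ zero ]       = sym (step -[1+ zero ])
  go -[1+ suc k ]      = trans (sym (step -[1+ suc k ])) (go -[1+ k ])

module Lemmas {c ℓ : Level} (F : Field c ℓ) where
  open Field F hiding (zero)
  open FieldDefs F
  open import Relation.Binary.Reasoning.Setoid setoid
  open import Algebra.Properties.Ring ring
    using (-0#≈0#; -‿involutive; -‿+-comm; -‿distribˡ-*; -‿distribʳ-*)
  open import Algebra.Properties.CommutativeSemigroup +-commutativeSemigroup using (interchange; x∙yz≈y∙xz)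

  private variable
    m h : ℕ
    a b f : ℕ → Carrier

  infix 4 _≐_
  _≐_ : (ℕ → Carrier) → (ℕ → Carrier) → Set ℓ
  A ≐ B = ∀ i → A i ≈ B i

  sumBelow-cong : ∀ n {f g : ℕ → Carrier} → (∀ j → j < n → f j ≈ g j) → sumBelow n f ≈ sumBelow n g
  sumBelow-cong zero    f≈g = refl
  sumBelow-cong (suc n) f≈g =
    +-cong (sumBelow-cong n (λ j j<n → f≈g j (ℕ.m<n⇒m<1+n j<n))) (f≈g n (ℕ.n<1+n n))

  sumBelow-+ : ∀ n f g → sumBelow n (λ j → f j + g j) ≈ sumBelow n f + sumBelow n g
  sumBelow-+ zero    f g = sym (+-identityˡ 0#)
  sumBelow-+ (suc n) f g = trans (+-cong (sumBelow-+ n f g) refl) (interchange _ _ _ _)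

  sumBelow-neg : ∀ n f → sumBelow n (λ j → - f j) ≈ - sumBelow n f
  sumBelow-neg zero    f = sym -0#≈0#
  sumBelow-neg (suc n) f = trans (+-cong (sumBelow-neg n f) refl) (-‿+-comm _ _)

  sumBelow-zero : ∀ n → sumBelow n (λ _ → 0#) ≈ 0#
  sumBelow-zero zero    = refl
  sumBelow-zero (suc n) = trans (+-cong (sumBelow-zero n) refl) (+-identityˡ 0#)

  sumBelow-suc : ∀ n f → sumBelow (suc n) f ≈ f 0 + sumBelow n (λ j → f (suc j))
  sumBelow-suc zero    f = +-comm 0# (f 0)
  sumBelow-suc (suc n) f = trans (+-cong (sumBelow-suc n f) refl) (+-assoc _ _ _)

  sumBelow-split : ∀ n k f → sumBelow (n ℕ.+ k) f ≈ sumBelow n f + sumBelow k (λ i → f (n ℕ.+ i))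
  sumBelow-split n zero    f rewrite ℕ.+-identityʳ n = sym (+-identityʳ _)
  sumBelow-split n (suc k) f rewrite ℕ.+-suc n k =
    trans (+-cong (sumBelow-split n k f) refl) (+-assoc _ _ _)

  sumBelow-reverse : ∀ n f → sumBelow n f ≈ sumBelow n (λ i → f (n ∸ suc i))
  sumBelow-reverse zero    f = refl
  sumBelow-reverse (suc n) f = begin
    sumBelow n f + f n                                  ≈⟨ +-comm _ _ ⟩
    f n + sumBelow n f                                  ≈⟨ +-cong refl (sumBelow-reverse n f) ⟩
    f n + sumBelow n (λ i → f (n ∸ suc i))              ≈⟨ sumBelow-suc n _ ⟨
    sumBelow (suc n) (λ i → f (suc n ∸ suc i))          ∎

  ×1-homo-+ : ∀ m n → (m ℕ.+ n) ×1 ≈ m ×1 + n ×1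
  ×1-homo-+ zero    n = sym (+-identityˡ _)
  ×1-homo-+ (suc m) n = trans (+-cong refl (×1-homo-+ m n)) (sym (+-assoc _ _ _))

  ι-⊖ : ∀ m n → ι (m ℤ.⊖ n) ≈ m ×1 + - (n ×1)
  ι-⊖ m       zero    = sym (trans (+-cong refl -0#≈0#) (+-identityʳ _))
  ι-⊖ zero    (suc n) = sym (+-identityˡ _)
  ι-⊖ (suc m) (suc n) = begin
    ι (suc m ℤ.⊖ suc n)               ≡⟨ ≡.cong ι (ℤ.[1+m]⊖[1+n]≡m⊖n m n) ⟩
    ι (m ℤ.⊖ n)                       ≈⟨ ι-⊖ m n ⟩
    m ×1 + - (n ×1)                   ≈⟨ +-identityˡ _ ⟨
    0# + (m ×1 + - (n ×1))            ≈⟨ +-cong (-‿inverseʳ 1#) refl ⟨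
    (1# + - 1#) + (m ×1 + - (n ×1))   ≈⟨ interchange _ _ _ _ ⟩
    (1# + m ×1) + (- 1# + - (n ×1))   ≈⟨ +-cong refl (-‿+-comm _ _) ⟩
    (1# + m ×1) + - (1# + n ×1)       ∎

  ι-homo-+ : ∀ i j → ι (i ℤ.+ j) ≈ ι i + ι j
  ι-homo-+ (+ m)    (+ n)    = ×1-homo-+ m n
  ι-homo-+ (+ m)    -[1+ n ] = ι-⊖ m (suc n)
  ι-homo-+ -[1+ m ] (+ n)    = trans (ι-⊖ n (suc m)) (+-comm _ _)
  ι-homo-+ -[1+ m ] -[1+ n ] = begin
    - (suc (suc (m ℕ.+ n)) ×1)        ≡⟨ ≡.cong (λ k → - (suc k ×1)) (ℕ.+-suc m n) ⟨
    - ((suc m ℕ.+ suc n) ×1)          ≈⟨ -‿cong (×1-homo-+ (suc m) (suc n)) ⟩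
    - (suc m ×1 + suc n ×1)           ≈⟨ -‿+-comm _ _ ⟨
    - (suc m ×1) + - (suc n ×1)       ∎

  infixl 7 _⋆_
  _⋆_ : (ℕ → Carrier) → (ℕ → Carrier) → ℕ → Carrier
  (A ⋆ B) s = sumTo s (λ j → A (s ∸ j) * B j)

  [1+x]* : (ℕ → Carrier) → ℕ → Carrier
  [1+x]* A zero    = A zero
  [1+x]* A (suc i) = A (suc i) + A i

  -- entry a k n is definitionally ([1+x]^ n ⋆ a) k.
  [1+x]^ : ℤ → ℕ → Carrier
  [1+x]^ n i = ι (binom n i)

  ⋆-cong : ∀ {A A′ B B′} → A ≐ A′ → B ≐ B′ → A ⋆ B ≐ A′ ⋆ B′
  ⋆-cong A≐A′ B≐B′ s = sumBelow-cong (suc s) (λ j _ → *-cong (A≐A′ _) (B≐B′ j))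

  ⋆-comm : ∀ A B → A ⋆ B ≐ B ⋆ A
  ⋆-comm A B s = begin
    sumTo s (λ j → A (s ∸ j) * B j)                ≈⟨ sumBelow-reverse (suc s) _ ⟩
    sumTo s (λ j → A (s ∸ (s ∸ j)) * B (s ∸ j))    ≈⟨ sumBelow-cong (suc s) reflect ⟩
    sumTo s (λ j → B (s ∸ j) * A j)                ∎
    where
    reflect : ∀ j → j < suc s → A (s ∸ (s ∸ j)) * B (s ∸ j) ≈ B (s ∸ j) * A j
    reflect j j<1+s = trans (*-comm _ _) (*-cong refl (reflexive (≡.cong A (ℕ.m∸[m∸n]≡n (s≤s⁻¹ j<1+s)))))

  [1+x]*-cong : ∀ {A B} → A ≐ B → [1+x]* A ≐ [1+x]* B
  [1+x]*-cong A≐B zero    = A≐B zero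
  [1+x]*-cong A≐B (suc i) = +-cong (A≐B (suc i)) (A≐B i)

  ⋆-[1+x]*ʳ : ∀ A B → A ⋆ [1+x]* B ≐ [1+x]* (A ⋆ B)
  ⋆-[1+x]*ʳ A B zero    = refl
  ⋆-[1+x]*ʳ A B (suc s) = begin
    (A ⋆ [1+x]* B) (suc s)
      ≈⟨ sumBelow-suc (suc s) _ ⟩
    A (suc s) * B 0 + sumTo s (λ j → A (s ∸ j) * (B (suc j) + B j))
      ≈⟨ +-cong refl (sumBelow-cong (suc s) (λ j _ → distribˡ (A (s ∸ j)) _ _)) ⟩
    A (suc s) * B 0 + sumTo s (λ j → A (s ∸ j) * B (suc j) + A (s ∸ j) * B j)
      ≈⟨ +-cong refl (sumBelow-+ (suc s) _ _) ⟩
    A (suc s) * B 0 + (sumTo s (λ j → A (s ∸ j) * B (suc j)) + (A ⋆ B) s)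
      ≈⟨ +-assoc _ _ _ ⟨
    (A (suc s) * B 0 + sumTo s (λ j → A (s ∸ j) * B (suc j))) + (A ⋆ B) s
      ≈⟨ +-cong (sumBelow-suc (suc s) _) refl ⟨
    (A ⋆ B) (suc s) + (A ⋆ B) s
      ∎

  ⋆-[1+x]*ˡ : ∀ A B → [1+x]* A ⋆ B ≐ [1+x]* (A ⋆ B)
  ⋆-[1+x]*ˡ A B s = begin
    ([1+x]* A ⋆ B) s    ≈⟨ ⋆-comm _ B s ⟩
    (B ⋆ [1+x]* A) s    ≈⟨ ⋆-[1+x]*ʳ B A s ⟩
    [1+x]* (B ⋆ A) s    ≈⟨ [1+x]*-cong (⋆-comm B A) s ⟩
    [1+x]* (A ⋆ B) s    ∎

  [1+x]^-suc : ∀ n → [1+x]^ (ℤ.suc n) ≐ [1+x]* ([1+x]^ n)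
  [1+x]^-suc n zero    = reflexive (≡.cong ι (≡.trans (binom-zero (ℤ.suc n)) (≡.sym (binom-zero n))))
  [1+x]^-suc n (suc i) = trans (reflexive (≡.cong ι (binom-pascal n i))) (ι-homo-+ (binom n (suc i)) (binom n i))

  [1+x]^-suc-⋆ : ∀ n X → [1+x]^ (ℤ.suc n) ⋆ X ≐ [1+x]* ([1+x]^ n ⋆ X)
  [1+x]^-suc-⋆ n X s = trans (⋆-cong ([1+x]^-suc n) (λ _ → refl) s) (⋆-[1+x]*ˡ _ X s)

  [1+x]^0-⋆ : ∀ X → [1+x]^ (+ 0) ⋆ X ≐ X
  [1+x]^0-⋆ X k = begin
    ([1+x]^ (+ 0) ⋆ X) k
      ≈⟨ ⋆-comm _ X k ⟩
    (X ⋆ [1+x]^ (+ 0)) k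
      ≈⟨ sumBelow-suc k _ ⟩
    X k * (1# + 0#) + sumBelow k (λ j → X (k ∸ suc j) * 0#)
      ≈⟨ +-cong (*-cong refl (+-identityʳ 1#)) (sumBelow-cong k (λ j _ → zeroʳ _)) ⟩
    X k * 1# + sumBelow k (λ _ → 0#)
      ≈⟨ +-cong (*-identityʳ _) (sumBelow-zero k) ⟩
    X k + 0#
      ≈⟨ +-identityʳ _ ⟩
    X k
      ∎

  binomialPairing : ℕ → (ℕ → Carrier) → (ℕ → Carrier) → ℤ → Carrier
  binomialPairing m a b l = (([1+x]^ l ⋆ b) ⋆ ([1+x]^ (ℤ.- l) ⋆ a)) m

  -- A factor 1 + x moves from (1+x)^(l+1) b to (1+x)^(-l-1) a.
  binomialPairing-suc : ∀ m a b n → binomialPairing m a b (ℤ.suc n) ≈ binomialPairing m a b n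
  binomialPairing-suc m a b n = begin
    (([1+x]^ (ℤ.suc n) ⋆ b) ⋆ A) m
      ≈⟨ ⋆-cong {B = A} ([1+x]^-suc-⋆ n b) (λ _ → refl) m ⟩
    ([1+x]* B ⋆ A) m
      ≈⟨ ⋆-[1+x]*ˡ B A m ⟩
    [1+x]* (B ⋆ A) m
      ≈⟨ ⋆-[1+x]*ʳ B A m ⟨
    (B ⋆ [1+x]* A) m
      ≈⟨ ⋆-cong {A = B} (λ _ → refl) ([1+x]^-suc-⋆ (ℤ.- ℤ.suc n) a) m ⟨
    (B ⋆ ([1+x]^ (ℤ.suc (ℤ.- ℤ.suc n)) ⋆ a)) m
      ≡⟨ ≡.cong (λ k → (B ⋆ ([1+x]^ k ⋆ a)) m) (suc-[-suc-i]≡-i n) ⟩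
    (B ⋆ ([1+x]^ (ℤ.- n) ⋆ a)) m
      ∎
    where
    A B : ℕ → Carrier
    A = [1+x]^ (ℤ.- ℤ.suc n) ⋆ a
    B = [1+x]^ n ⋆ b

  binomialPairing-invariant : ∀ m a b (l : ℤ) →
    sumTo m (λ k → entry a k (ℤ.- l) * entry b (m ∸ k) l) ≈ sumTo m (λ k → a k * b (m ∸ k))
  binomialPairing-invariant m a b l = begin
    sumTo m (λ k → entry a k (ℤ.- l) * entry b (m ∸ k) l)
      ≈⟨ sumBelow-cong (suc m) (λ _ _ → *-comm _ _) ⟩
    binomialPairing m a b l
      ≈⟨ suc-invariant⇒constant setoid (binomialPairing m a b) (binomialPairing-suc m a b) l ⟩
    binomialPairing m a b (+ 0)
      ≈⟨ ⋆-cong ([1+x]^0-⋆ b) ([1+x]^0-⋆ a) m ⟩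
    (b ⋆ a) m
      ≈⟨ sumBelow-cong (suc m) (λ _ _ → *-comm _ _) ⟩
    sumTo m (λ k → a k * b (m ∸ k))
      ∎

  x+x≈[1+1]*x : ∀ x → x + x ≈ (1# + 1#) * x
  x+x≈[1+1]*x x = sym (trans (distribʳ x 1# 1#) (+-cong (*-identityˡ x) (*-identityˡ x)))

  -x*-y≈x*y : ∀ x y → - x * - y ≈ x * y
  -x*-y≈x*y x y = begin
    - x * - y      ≈⟨ -‿distribˡ-* x (- y) ⟨
    - (x * - y)    ≈⟨ -‿cong (-‿distribʳ-* x y) ⟨
    - - (x * y)    ≈⟨ -‿involutive _ ⟩
    x * y          ∎

  Palindromic-* : Palindromic m a → Palindromic m b → Palindromic m (λ k → a k * b k)
  Palindromic-* pa pb k k≤m = *-cong (pa k k≤m) (pb k k≤m)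

  SkewPalindromic-* : SkewPalindromic m a → SkewPalindromic m b → Palindromic m (λ k → a k * b k)
  SkewPalindromic-* sa sb k k≤m = trans (*-cong (sa k k≤m) (sb k k≤m)) (-x*-y≈x*y _ _)

  Palindromic-*-SkewPalindromic : Palindromic m a → SkewPalindromic m b → SkewPalindromic m (λ k → a k * b k)
  Palindromic-*-SkewPalindromic pa sb k k≤m = trans (*-cong (pa k k≤m) (sb k k≤m)) (sym (-‿distribʳ-* _ _))

  SkewPalindromic-reflect : SkewPalindromic m b → ∀ k → k ≤ m → b (m ∸ k) ≈ - b k
  SkewPalindromic-reflect sb k k≤m = trans (sym (-‿involutive _)) (-‿cong (sym (sb k k≤m)))

  Palindromic⇒sumTo-odd : m ≡ suc (h ℕ.+ h) → Palindromic m f → sumTo m f ≈ (1# + 1#) * sumTo h f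
  Palindromic⇒sumTo-odd {h = h} {f = f} ≡.refl pal = begin
    sumBelow (suc (suc (h ℕ.+ h))) f
      ≡⟨ ≡.cong (λ n → sumBelow (suc n) f) (ℕ.+-suc h h) ⟨
    sumBelow (suc h ℕ.+ suc h) f
      ≈⟨ sumBelow-split (suc h) (suc h) f ⟩
    sumTo h f + sumTo h (λ i → f (suc h ℕ.+ i))
      ≈⟨ +-cong refl (sumBelow-cong (suc h) upper-half) ⟩
    sumTo h f + sumTo h (λ i → f (h ∸ i))
      ≈⟨ +-cong refl (sumBelow-reverse (suc h) f) ⟨
    sumTo h f + sumTo h f
      ≈⟨ x+x≈[1+1]*x _ ⟩
    (1# + 1#) * sumTo h f
      ∎
    where
    upper-half : ∀ i → i < suc h → f (suc h ℕ.+ i) ≈ f (h ∸ i)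
    upper-half i (s≤s i≤h) = trans (pal (suc h ℕ.+ i) (s≤s (ℕ.+-monoʳ-≤ h i≤h)))
                                   (reflexive (≡.cong f (ℕ.[m+n]∸[m+o]≡n∸o h h i)))

  Palindromic⇒sumTo-even : m ≡ h ℕ.+ h → Palindromic m f → sumTo m f ≈ f h + (1# + 1#) * sumBelow h f
  Palindromic⇒sumTo-even {h = h} {f = f} ≡.refl pal = begin
    sumBelow (suc (h ℕ.+ h)) f
      ≡⟨ ≡.cong (λ n → sumBelow n f) (ℕ.+-suc h h) ⟨
    sumBelow (h ℕ.+ suc h) f
      ≈⟨ sumBelow-split h (suc h) f ⟩
    sumBelow h f + sumTo h (λ i → f (h ℕ.+ i))
      ≈⟨ +-cong refl (sumBelow-suc h _) ⟩
    sumBelow h f + (f (h ℕ.+ 0) + sumBelow h (λ i → f (h ℕ.+ suc i)))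
      ≈⟨ +-cong refl (+-cong (reflexive (≡.cong f (ℕ.+-identityʳ h))) (sumBelow-cong h upper-half)) ⟩
    sumBelow h f + (f h + sumBelow h (λ i → f (h ∸ suc i)))
      ≈⟨ +-cong refl (+-cong refl (sumBelow-reverse h f)) ⟨
    sumBelow h f + (f h + sumBelow h f)
      ≈⟨ x∙yz≈y∙xz _ _ _ ⟩
    f h + (sumBelow h f + sumBelow h f)
      ≈⟨ +-cong refl (x+x≈[1+1]*x _) ⟩
    f h + (1# + 1#) * sumBelow h f
      ∎
    where
    upper-half : ∀ i → i < h → f (h ℕ.+ suc i) ≈ f (h ∸ suc i)
    upper-half i i<h = trans (pal (h ℕ.+ suc i) (ℕ.+-monoʳ-≤ h i<h))
                             (reflexive (≡.cong f (ℕ.[m+n]∸[m+o]≡n∸o h h (suc i))))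

  Palindromic⇒sumTo-*-reflect : Palindromic m b →
    sumTo m (λ k → a k * b (m ∸ k)) ≈ sumTo m (λ k → a k * b k)
  Palindromic⇒sumTo-*-reflect {m = m} pb =
    sumBelow-cong (suc m) (λ k k<1+m → *-cong refl (sym (pb k (s≤s⁻¹ k<1+m))))

  SkewPalindromic⇒sumTo-*-reflect : SkewPalindromic m b →
    sumTo m (λ k → a k * b (m ∸ k)) ≈ - sumTo m (λ k → a k * b k)
  SkewPalindromic⇒sumTo-*-reflect {m = m} {b = b} {a = a} sb = begin
    sumTo m (λ k → a k * b (m ∸ k))     ≈⟨ sumBelow-cong (suc m) reflect ⟩
    sumTo m (λ k → - (a k * b k))       ≈⟨ sumBelow-neg (suc m) _ ⟩
    - sumTo m (λ k → a k * b k)         ∎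
    where
    reflect : ∀ k → k < suc m → a k * b (m ∸ k) ≈ - (a k * b k)
    reflect k k<1+m = trans (*-cong refl (SkewPalindromic-reflect sb k (s≤s⁻¹ k<1+m))) (sym (-‿distribʳ-* _ _))

  Palindromic-pairing-odd : Palindromic m a → Palindromic m b → m % 2 ≡ 1 →
    sumTo m (λ k → a k * b (m ∸ k)) ≈ (1# + 1#) * sumTo (m / 2) (λ k → a k * b k)
  Palindromic-pairing-odd {m = m} pa pb odd = trans (Palindromic⇒sumTo-*-reflect pb)
    (Palindromic⇒sumTo-odd (m%2≡1⇒m≡1+[m/2+m/2] m odd) (Palindromic-* pa pb))

  Palindromic-pairing-even : Palindromic m a → Palindromic m b → m % 2 ≡ 0 →
    sumTo m (λ k → a k * b (m ∸ k)) ≈ a (m / 2) * b (m / 2) + (1# + 1#) * sumBelow (m / 2) (λ k → a k * b k)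
  Palindromic-pairing-even {m = m} pa pb even = trans (Palindromic⇒sumTo-*-reflect pb)
    (Palindromic⇒sumTo-even (m%2≡0⇒m≡m/2+m/2 m even) (Palindromic-* pa pb))

  module _ (charZero : CharZero) where

    1+1≉0 : ¬ (1# + 1# ≈ 0#)
    1+1≉0 1+1≈0 with charZero 2 (trans (+-cong refl (+-identityʳ 1#)) 1+1≈0)
    ... | ()

    x≈-x⇒x≈0 : ∀ x → x ≈ - x → x ≈ 0#
    x≈-x⇒x≈0 x x≈-x with inverse (1# + 1#) 1+1≉0
    ... | y , [1+1]*y≈1 = begin
      x                      ≈⟨ *-identityˡ x ⟨
      1# * x                 ≈⟨ *-cong (trans (sym [1+1]*y≈1) (*-comm _ y)) refl ⟩
      y * (1# + 1#) * x      ≈⟨ *-assoc y _ x ⟩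
      y * ((1# + 1#) * x)    ≈⟨ *-cong refl (x+x≈[1+1]*x x) ⟨
      y * (x + x)            ≈⟨ *-cong refl (trans (+-cong x≈-x refl) (-‿inverseˡ x)) ⟩
      y * 0#                 ≈⟨ zeroʳ y ⟩
      0#                     ∎

    SkewPalindromic⇒sumTo≈0 : SkewPalindromic m f → sumTo m f ≈ 0#
    SkewPalindromic⇒sumTo≈0 {m = m} {f = f} skew = x≈-x⇒x≈0 _ (begin
      sumTo m f                           ≈⟨ sumBelow-cong (suc m) (λ k k<1+m → skew k (s≤s⁻¹ k<1+m)) ⟩
      sumTo m (λ k → - f (m ∸ k))         ≈⟨ sumBelow-neg (suc m) _ ⟩
      - sumTo m (λ k → f (m ∸ k))         ≈⟨ -‿cong (sumBelow-reverse (suc m) f) ⟨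
      - sumTo m f                         ∎)

    SkewPalindromic⇒middle≈0 : m ≡ h ℕ.+ h → SkewPalindromic m a → a h ≈ 0#
    SkewPalindromic⇒middle≈0 {h = h} {a = a} ≡.refl skew =
      x≈-x⇒x≈0 _ (trans (skew h (ℕ.m≤m+n h h)) (-‿cong (reflexive (≡.cong a (ℕ.m+n∸n≡m h h)))))

    SkewPalindromic-pairing : SkewPalindromic m a → SkewPalindromic m b →
      sumTo m (λ k → a k * b (m ∸ k)) ≈ - ((1# + 1#) * sumTo (m / 2) (λ k → a k * b k))
    SkewPalindromic-pairing {m = m} {a = a} {b = b} sa sb =
      trans (SkewPalindromic⇒sumTo-*-reflect sb) (-‿cong (sum-by-parity (m%2≡0⊎m%2≡1 m)))
      where
      ab : ℕ → Carrier
      ab k = a k * b k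
      sum-by-parity : m % 2 ≡ 0 ⊎ m % 2 ≡ 1 → sumTo m ab ≈ (1# + 1#) * sumTo (m / 2) ab
      sum-by-parity (inj₂ odd)  = Palindromic⇒sumTo-odd (m%2≡1⇒m≡1+[m/2+m/2] m odd) (SkewPalindromic-* sa sb)
      sum-by-parity (inj₁ even) = begin
        sumTo m ab
          ≈⟨ Palindromic⇒sumTo-even m≡half+half (SkewPalindromic-* sa sb) ⟩
        ab half + (1# + 1#) * sumBelow half ab ≈⟨ +-cong ab[half]≈0 refl ⟩
        0# + (1# + 1#) * sumBelow half ab      ≈⟨ +-identityˡ _ ⟩
        (1# + 1#) * sumBelow half ab           ≈⟨ *-cong refl (+-identityʳ _) ⟨
        (1# + 1#) * (sumBelow half ab + 0#)    ≈⟨ *-cong refl (+-cong refl ab[half]≈0) ⟨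
        (1# + 1#) * sumTo half ab              ∎
        where
        half : ℕ
        half = m / 2
        m≡half+half : m ≡ half ℕ.+ half
        m≡half+half = m%2≡0⇒m≡m/2+m/2 m even
        ab[half]≈0 : ab half ≈ 0#
        ab[half]≈0 = trans (*-cong (SkewPalindromic⇒middle≈0 m≡half+half sa) refl) (zeroˡ _)

    Palindromic-SkewPalindromic-pairing : Palindromic m a → SkewPalindromic m b →
      sumTo m (λ k → a k * b (m ∸ k)) ≈ 0#
    Palindromic-SkewPalindromic-pairing {m = m} {a = a} {b = b} pa sb = begin
      sumTo m (λ k → a k * b (m ∸ k))    ≈⟨ SkewPalindromic⇒sumTo-*-reflect sb ⟩
      - sumTo m (λ k → a k * b k)
        ≈⟨ -‿cong (SkewPalindromic⇒sumTo≈0 (Palindromic-*-SkewPalindromic pa sb)) ⟩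
      - 0#                               ≈⟨ -0#≈0# ⟩
      0#                                 ∎

proposition7p4 : ∀ {c ℓ : Level} (F : Field c ℓ) →
    let open Field F in let open FieldDefs F in
    CharZero →
    (m : ℕ) (a b : ℕ → Carrier) →
    HasDegree m a → HasDegree m b →
    -- p and q both palindromic
    ((Palindromic m a → Palindromic m b →
        (∀ (l : ℤ) → sumTo m (λ k → entry a k (ℤ.- l) * entry b (m ∸ k) l)
                       ≈ sumTo m (λ k → a k * b (m ∸ k)))
      × (m % 2 ≡ 1 → sumTo m (λ k → a k * b (m ∸ k))
                       ≈ (1# + 1#) * sumTo (m / 2) (λ k → a k * b k))
      × (m % 2 ≡ 0 → sumTo m (λ k → a k * b (m ∸ k))
                       ≈ a (m / 2) * b (m / 2) + (1# + 1#) * sumBelow (m / 2) (λ k → a k * b k)))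
    -- p and q both skew-palindromic
    × (SkewPalindromic m a → SkewPalindromic m b →
        (∀ (l : ℤ) → sumTo m (λ k → entry a k (ℤ.- l) * entry b (m ∸ k) l)
                       ≈ sumTo m (λ k → a k * b (m ∸ k)))
      × (sumTo m (λ k → a k * b (m ∸ k))
                       ≈ - ((1# + 1#) * sumTo (m / 2) (λ k → a k * b k))))
    -- p palindromic, q skew-palindromic
    × (Palindromic m a → SkewPalindromic m b →
        (∀ (l : ℤ) → sumTo m (λ k → entry a k (ℤ.- l) * entry b (m ∸ k) l)
                       ≈ sumTo m (λ k → a k * b (m ∸ k)))
      × (sumTo m (λ k → a k * b (m ∸ k)) ≈ 0#)))
proposition7p4 F charZero m a b _ _ =
    (λ pa pb → binomialPairing-invariant m a b , Palindromic-pairing-odd pa pb , Palindromic-pairing-even pa pb)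
  , (λ sa sb → binomialPairing-invariant m a b , SkewPalindromic-pairing charZero sa sb)
  , (λ pa sb → binomialPairing-invariant m a b , Palindromic-SkewPalindromic-pairing charZero pa sb)
  where open Lemmas F
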